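{- Fix positive integers $k,d,h$ and a (deterministic) label subset $L'\subseteq L$ with $|L'|=c$; put $a=c/k$ and assume $d>8a$. Let $\mu<\nu$ be elements of $\Phi'$ and $i\in\{1,\dots,h\}$. Then, over the random choice of the permutations, the probability that the two endpoints of the chain $C^i_{\mu\nu}$ are disconnected within $C^i_{\mu\nu}$ after removing all its edges whose labels lie in $L'$ is at most \[ 1-\left(1-\frac{8a}{d}\right)^{4a}. \]
   Context: Random instance $\mathcal{I}(k,d,h)$: $\Phi=\{1,\dots,k\}$, $[d]=\{1,\dots,d\}$, $L=\{(\mu,j):\mu\in\Phi,j\in[d]\}$. A chain for elements $\mu,\nu$ and permutation $\sigma$ of $[d]$ has vertices $x_0,\dots,x_d$ and for each $j\in[d]$ a 4-cycle on $x_{j-1},u_j,x_j,w_j$ whose top edges $x_{j-1}u_j,u_jx_j$ are labeled $(\mu,j)$ and bottom edges $x_{j-1}w_j,w_jx_j$ are labeled $(\nu,\sigma(j))$; its endpoints are $x_0,x_d$. For each $\mu<\nu$ in $\Phi$ there are $h$ chains $C^1_{\mu\nu},\dots,C^h_{\mu\nu}$ for $\mu,\nu$, with permutations $\sigma^1_{\mu\nu},\dots,\sigma^h_{\mu\nu}$; all permutations (over all $\mu,\nu,i$) are independent and uniformly random permutations of $[d]$. For $L'\subseteq L$ define $J_\mu=\{j\in[d]:(\mu,j)\in L'\}$ for $\mu\in\Phi$, and the light ground set $\Phi'=\{\mu\in\Phi: |J_\mu|\le 4a\}$ where $a=|L'|/k$. -}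

module Defs where

open import Data.Nat as ℕ using (ℕ; zero; suc)
open import Data.Fin as Fin using (Fin; inject₁; fromℕ)
open import Data.Bool using (Bool; true; false; _∧_)
open import Data.Vec as Vec using (Vec; lookup; []; _∷_)
open import Data.List as List using (List; []; _∷_; concatMap; map; filter; length)
open import Data.Nat.ListAction using (sum)
open import Data.List.Relation.Unary.Unique.Propositional using (Unique)
import Data.List.Relation.Unary.Unique.DecPropositional as UDec
open import Data.Fin.Properties using (_≟_)
open import Data.Integer using (+_)
open import Data.Rational as ℚ using (ℚ; 0ℚ; 1ℚ)
open import Data.Product using (_×_)
open import Relation.Binary.PropositionalEquality using (_≡_)
open import Relation.Binary.Construct.Closure.ReflexiveTransitive using (Star)
open import Relation.Nullary using (Dec; ¬_; does)

-- Index conventions: Φ = {1..k} is Fin k, [d] = {1..d} is Fin d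
-- (shifted by one: paper's j ∈ [d] is Fin.toℕ j + 1).
-- A label subset L' ⊆ L = Φ × [d] is given by its characteristic
-- function  L' : Fin k → Fin d → Bool.

countTrue : ∀ {n} → (Fin n → Bool) → ℕ
countTrue {n} f = length (filter (λ j → f j Data.Bool.≟ true) (List.allFin n))
  where import Data.Bool

∣J∣ : ∀ {k d} → (Fin k → Fin d → Bool) → Fin k → ℕ
∣J∣ L' μ = countTrue (L' μ)

∣L'∣ : ∀ {k d} → (Fin k → Fin d → Bool) → ℕ
∣L'∣ {k} L' = sum (map (∣J∣ L') (List.allFin k))

-- μ ∈ Φ'  iff  |J_μ| ≤ 4a  with a = |L'|/k, i.e. k·|J_μ| ≤ 4·|L'|  (k > 0)
Light : ∀ {k d} → (Fin k → Fin d → Bool) → Fin k → Set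
Light {k} L' μ = k ℕ.* ∣J∣ L' μ ℕ.≤ 4 ℕ.* ∣L'∣ L'

data Vertex (d : ℕ) : Set where
  x : Fin (suc d) → Vertex d
  u : Fin d → Vertex d
  w : Fin d → Vertex d

-- Edges are undirected, so both directions are listed.
-- Top edges x_{j-1}u_j, u_j x_j have label (μ , j);
-- bottom edges x_{j-1}w_j, w_j x_j have label (ν , σ(j)).
data Step {k d : ℕ} (L' : Fin k → Fin d → Bool) (μ ν : Fin k) (σ : Vec (Fin d) d)
          : Vertex d → Vertex d → Set where
  top₁  : ∀ j → L' μ j ≡ false → Step L' μ ν σ (x (inject₁ j)) (u j)
  top₁' : ∀ j → L' μ j ≡ false → Step L' μ ν σ (u j) (x (inject₁ j))
  top₂  : ∀ j → L' μ j ≡ false → Step L' μ ν σ (u j) (x (Fin.suc j))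
  top₂' : ∀ j → L' μ j ≡ false → Step L' μ ν σ (x (Fin.suc j)) (u j)
  bot₁  : ∀ j → L' ν (lookup σ j) ≡ false → Step L' μ ν σ (x (inject₁ j)) (w j)
  bot₁' : ∀ j → L' ν (lookup σ j) ≡ false → Step L' μ ν σ (w j) (x (inject₁ j))
  bot₂  : ∀ j → L' ν (lookup σ j) ≡ false → Step L' μ ν σ (w j) (x (Fin.suc j))
  bot₂' : ∀ j → L' ν (lookup σ j) ≡ false → Step L' μ ν σ (x (Fin.suc j)) (w j)

EndpointsConnected : ∀ {k d} → (Fin k → Fin d → Bool) → Fin k → Fin k → Vec (Fin d) d → Set
EndpointsConnected {d = d} L' μ ν σ = Star (Step L' μ ν σ) (x Fin.zero) (x (fromℕ d))

-- Uniform random permutation of [d]: permutations are the injective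
-- vectors σ ∈ Vec (Fin d) d (all entries distinct), enumerated explicitly.

allVecs : (n m : ℕ) → List (Vec (Fin m) n)
allVecs zero    m = [] ∷ []
allVecs (suc n) m = concatMap (λ i → map (i ∷_) (allVecs n m)) (List.allFin m)

isPerm : ∀ {d} → Vec (Fin d) d → Bool
isPerm σ = does (UDec.unique? _≟_ (Vec.toList σ))

allPerms : (d : ℕ) → List (Vec (Fin d) d)
allPerms d = filter (λ σ → isPerm σ Data.Bool.≟ true) (allVecs d d)
  where import Data.Bool

-- n / m as a rational (m = 0 gives 0; only used with m > 0)
_÷ℕ_ : ℕ → ℕ → ℚ
n ÷ℕ zero  = 0ℚ
n ÷ℕ suc m = + n ℚ./ suc m

Prob : ∀ d → (E : Vec (Fin d) d → Set) → ((σ : Vec (Fin d) d) → Dec (E σ)) → ℚ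
Prob d E dec = length (filter dec (allPerms d)) ÷ℕ length (allPerms d)

_^ℚ_ : ℚ → ℕ → ℚ
q ^ℚ zero  = 1ℚ
q ^ℚ suc n = q ℚ.* (q ^ℚ n)

-- If σ maps J_μ into the complement of J_ν, each 4-cycle of the chain keeps its top or its
-- bottom path, so the endpoints stay connected.  Choosing the entries of σ one at a time shows
-- that there are q(q−1)⋯(q−a+1)·(d−a)! such permutations, where a = |J_μ| and q = d − |J_ν|; so
-- the connection probability 1 − P is at least ∏_{s<a} (q−s)/(d−s).  Since μ and ν are light,
-- k·a and k·|J_ν| are at most 4c, which makes every factor at least 1 − 8c/(dk) and gives
-- (1 − P)^k ≥ (1 − 8c/(dk))^(a·k) ≥ (1 − 8c/(dk))^(4c).

module Submission where

open import Data.Nat using (ℕ)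
open import Data.Fin using (Fin)
open import Data.Bool using (Bool)

module BooleanCounting where

  open import Data.Nat using (zero; suc; _+_; _*_; _≤_; z≤n; s≤s)
  open import Data.Nat.Properties
    using (+-assoc; +-suc; n≤1+n; ≤-trans; +-0-monoid; +-commutativeSemigroup)
  open import Data.Bool using (true; false; not; _∧_; if_then_else_)
  import Data.Bool as Bool
  open import Data.Fin using (zero; suc)
  open import Data.Fin.Properties using (_≟_)
  open import Data.List using (List; []; _∷_; _++_; map; filter; length; concatMap; tabulate)
  open import Data.Product using (_×_; _,_)
  open import Data.Empty using (⊥-elim)
  open import Function using (id)
  open import Relation.Binary.PropositionalEquality
  open import Relation.Nullary using (yes; no; ¬_; does)
  open import Relation.Unary using (Decidable)
  open import Algebra.Properties.Monoid.Sum +-0-monoid public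
    using (sum; sum-cong-≗; sum-replicate-zero)
  import Algebra.Properties.CommutativeSemigroup +-commutativeSemigroup as +-CS
  open import Data.Vec as Vec using (Vec)
  open import Defs using (allVecs)

  bit : Bool → ℕ
  bit true = 1
  bit false = 0

  bit+bit-not : ∀ b → bit b + bit (not b) ≡ 1
  bit+bit-not true  = refl
  bit+bit-not false = refl

  count : ∀ {A : Set} → (A → Bool) → List A → ℕ
  count p [] = 0
  count p (x ∷ xs) = bit (p x) + count p xs

  countᶠ : ∀ {n} → (Fin n → Bool) → ℕ
  countᶠ c = sum (λ i → bit (c i))

  module _ {A : Set} where

    count-++ : ∀ (p : A → Bool) xs ys → count p (xs ++ ys) ≡ count p xs + count p ys
    count-++ p [] ys = refl
    count-++ p (x ∷ xs) ys =
      trans (cong (bit (p x) +_) (count-++ p xs ys)) (sym (+-assoc (bit (p x)) _ _))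

    count-false : ∀ xs → count (λ (_ : A) → false) xs ≡ 0
    count-false [] = refl
    count-false (x ∷ xs) = count-false xs

    count≡length-filter : ∀ (p : A → Bool) xs →
                          count p xs ≡ length (filter (λ x → p x Bool.≟ true) xs)
    count≡length-filter p [] = refl
    count≡length-filter p (x ∷ xs) with p x
    ... | true  = cong suc (count≡length-filter p xs)
    ... | false = count≡length-filter p xs

    count-mono : ∀ {p q : A → Bool} → (∀ x → p x ≡ true → q x ≡ true) →
                 ∀ xs → count p xs ≤ count q xs
    count-mono p⊆q [] = z≤n
    count-mono {p} {q} p⊆q (x ∷ xs) with p x in px | q x in qx
    ... | true  | true  = s≤s (count-mono p⊆q xs)
    ... | true  | false with () ← trans (sym (p⊆q x px)) qx
    ... | false | true  = ≤-trans (count-mono p⊆q xs) (n≤1+n _)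
    ... | false | false = count-mono p⊆q xs

    count-filter : ∀ {p q : A → Bool} → (∀ x → q x ≡ true → p x ≡ true) →
                   ∀ xs → count q (filter (λ x → p x Bool.≟ true) xs) ≡ count q xs
    count-filter q⊆p [] = refl
    count-filter {p} {q} q⊆p (x ∷ xs) with p x in px
    ... | true = cong (bit (q x) +_) (count-filter q⊆p xs)
    ... | false with q x in qx
    ...   | false = count-filter q⊆p xs
    ...   | true with () ← trans (sym (q⊆p x qx)) px

    length-filter+count≤length : ∀ {P : A → Set} (P? : Decidable P) (q : A → Bool) →
      (∀ x → q x ≡ true → ¬ P x) → ∀ xs → length (filter P? xs) + count q xs ≤ length xs
    length-filter+count≤length P? q disjoint [] = z≤n
    length-filter+count≤length P? q disjoint (x ∷ xs) with P? x | q x in qx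
    ... | yes px | true  = ⊥-elim (disjoint x qx px)
    ... | yes px | false = s≤s (length-filter+count≤length P? q disjoint xs)
    ... | no _   | true  =
      subst (_≤ suc (length xs)) (sym (+-suc _ _)) (s≤s (length-filter+count≤length P? q disjoint xs))
    ... | no _   | false = ≤-trans (length-filter+count≤length P? q disjoint xs) (n≤1+n _)

  count-map : ∀ {A B : Set} (p : B → Bool) (f : A → B) xs →
              count p (map f xs) ≡ count (λ x → p (f x)) xs
  count-map p f [] = refl
  count-map p f (x ∷ xs) = cong (bit (p (f x)) +_) (count-map p f xs)

  count-tabulate : ∀ {A : Set} {n} (p : A → Bool) (g : Fin n → A) →
                   count p (tabulate g) ≡ countᶠ (λ i → p (g i))
  count-tabulate {n = zero} p g = refl
  count-tabulate {n = suc n} p g = cong (bit (p (g zero)) +_) (count-tabulate p (λ i → g (suc i)))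

  count-concatMap : ∀ {A B : Set} {n} (p : A → Bool) (f : B → List A) (g : Fin n → B) →
                    count p (concatMap f (tabulate g)) ≡ sum (λ i → count p (f (g i)))
  count-concatMap {n = zero} p f g = refl
  count-concatMap {n = suc n} p f g =
    trans (count-++ p (f (g zero)) _)
          (cong (count p (f (g zero)) +_) (count-concatMap p f (λ i → g (suc i))))

  count-allVecs-suc : ∀ {n m} (p : Vec (Fin m) (suc n) → Bool) →
    count p (allVecs (suc n) m) ≡ sum (λ i → count (λ v → p (i Vec.∷ v)) (allVecs n m))
  count-allVecs-suc {n} {m} p =
    trans (count-concatMap p (λ i → map (i Vec.∷_) (allVecs n m)) id)
          (sum-cong-≗ (λ i → count-map p (i Vec.∷_) (allVecs n m)))

  countᶠ≤ : ∀ {n} (c : Fin n → Bool) → countᶠ c ≤ n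
  countᶠ≤ {zero} c = z≤n
  countᶠ≤ {suc n} c with c zero
  ... | true  = s≤s (countᶠ≤ (λ i → c (suc i)))
  ... | false = ≤-trans (countᶠ≤ (λ i → c (suc i))) (n≤1+n _)

  countᶠ+countᶠ-not : ∀ {n} (c : Fin n → Bool) → countᶠ c + countᶠ (λ i → not (c i)) ≡ n
  countᶠ+countᶠ-not {zero} c = refl
  countᶠ+countᶠ-not {suc n} c with c zero
  ... | true  = cong suc (countᶠ+countᶠ-not (λ i → c (suc i)))
  ... | false = trans (+-suc _ _) (cong suc (countᶠ+countᶠ-not (λ i → c (suc i))))

  sum-by-class : ∀ {n} (h : Fin n → ℕ) (F B : Fin n → Bool) (α β : ℕ) →
    (∀ i → F i ≡ false → h i ≡ 0) →
    (∀ i → F i ≡ true → B i ≡ true → h i ≡ α) →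
    (∀ i → F i ≡ true → B i ≡ false → h i ≡ β) →
    sum h ≡ countᶠ (λ i → F i ∧ B i) * α + countᶠ (λ i → F i ∧ not (B i)) * β
  sum-by-class {zero} h F B α β h₀ hα hβ = refl
  sum-by-class {suc n} h F B α β h₀ hα hβ
    with ih ← sum-by-class (λ i → h (suc i)) (λ i → F (suc i)) (λ i → B (suc i)) α β
                (λ i → h₀ (suc i)) (λ i → hα (suc i)) (λ i → hβ (suc i))
    with F zero in F₀ | B zero in B₀
  ... | false | _     = cong₂ _+_ (h₀ zero F₀) ih
  ... | true  | true  = trans (cong₂ _+_ (hα zero F₀ B₀) ih) (sym (+-assoc α (P * α) (Q * β)))
    where P = countᶠ (λ i → F (suc i) ∧ B (suc i)); Q = countᶠ (λ i → F (suc i) ∧ not (B (suc i)))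
  ... | true  | false = trans (cong₂ _+_ (hβ zero F₀ B₀) ih) (+-CS.x∙yz≈y∙xz β (P * α) (Q * β))
    where P = countᶠ (λ i → F (suc i) ∧ B (suc i)); Q = countᶠ (λ i → F (suc i) ∧ not (B (suc i)))

  remove : ∀ {n} → Fin n → (Fin n → Bool) → Fin n → Bool
  remove i F j = if does (j ≟ i) then false else F j

  module _ {n} {i j : Fin n} {F : Fin n → Bool} where

    remove-true⁻ : remove i F j ≡ true → i ≢ j × F j ≡ true
    remove-true⁻ e with j ≟ i
    ... | yes _   with () ← e
    ... | no j≢i  = (λ i≡j → j≢i (sym i≡j)) , e

    remove-true⁺ : i ≢ j × F j ≡ true → remove i F j ≡ true
    remove-true⁺ (i≢j , Fj) with j ≟ i
    ... | yes j≡i = ⊥-elim (i≢j (sym j≡i))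
    ... | no _    = Fj

  countᶠ-remove : ∀ {n} (F c : Fin n → Bool) i → F i ≡ true →
    countᶠ (λ j → F j ∧ c j) ≡ bit (c i) + countᶠ (λ j → remove i F j ∧ c j)
  countᶠ-remove {suc n} F c zero Fi rewrite Fi = refl
  countᶠ-remove {suc n} F c (suc i) Fi =
    trans (cong (bit (F zero ∧ c zero) +_) (countᶠ-remove (λ j → F (suc j)) (λ j → c (suc j)) i Fi))
          (+-CS.x∙yz≈y∙xz (bit (F zero ∧ c zero)) (bit (c (suc i))) _)

module FallingFactorial where

  open import Data.Nat using (zero; suc; _+_; _*_; _∸_; _^_; _≤_; _<_; _!; s≤s)
  open import Data.Nat.Properties
  open import Data.Nat.Combinatorics.Base public using (_P′_)
  open import Data.Sum using (inj₁; inj₂)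
  open import Relation.Binary.PropositionalEquality
  open import Relation.Nullary using (Dec; yes; no)
  import Algebra.Properties.CommutativeSemigroup *-commutativeSemigroup as *-CS
  open import Data.Nat.Tactic.RingSolver using (solve-∀)

  *-P′-pred : ∀ q a → q * ((q ∸ 1) P′ a) ≡ q P′ suc a
  *-P′-pred zero    a       = cong (_* (0 P′ a)) (sym (0∸n≡0 a))
  *-P′-pred (suc q) zero    = refl
  *-P′-pred (suc q) (suc a) =
    trans (*-CS.x∙yz≈y∙xz (suc q) (q ∸ a) (q P′ a)) (cong ((q ∸ a) *_) (*-P′-pred (suc q) a))

  P′-vanishes : ∀ {q a} → q < a → q P′ a ≡ 0
  P′-vanishes {q} {suc a} (s≤s q≤a) with m≤n⇒m<n∨m≡n q≤a
  ... | inj₁ q<a  = trans (cong ((q ∸ a) *_) (P′-vanishes q<a)) (*-zeroʳ (q ∸ a))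
  ... | inj₂ refl = cong (_* (q P′ q)) (n∸n≡0 q)

  P′-*-! : ∀ {n a} → a ≤ n → (n P′ a) * (n ∸ a) ! ≡ n !
  P′-*-! {n} {zero}  _ = +-identityʳ (n !)
  P′-*-! {suc n} {suc a} (s≤s a≤n) = begin
      (suc n ∸ a) * (suc n P′ a) * (n ∸ a) !
    ≡⟨ cong (λ t → t * (suc n P′ a) * (n ∸ a) !) [n+1]∸a ⟩
      suc (n ∸ a) * (suc n P′ a) * (n ∸ a) !
    ≡⟨ *-CS.xy∙z≈y∙xz (suc (n ∸ a)) (suc n P′ a) ((n ∸ a) !) ⟩
      (suc n P′ a) * (suc (n ∸ a)) !
    ≡⟨ cong (λ t → (suc n P′ a) * t !) (sym [n+1]∸a) ⟩
      (suc n P′ a) * (suc n ∸ a) !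
    ≡⟨ P′-*-! (m≤n⇒m≤1+n a≤n) ⟩
      suc n ! ∎
    where
    open ≡-Reasoning
    [n+1]∸a : suc n ∸ a ≡ suc (n ∸ a)
    [n+1]∸a = +-∸-assoc 1 a≤n

  P′-recurrence : ∀ p q n a → p + q ≡ suc n → a ≤ n →
    p * ((q P′ a) * (n ∸ a) !) + q * (((q ∸ 1) P′ a) * (n ∸ a) !) ≡ (q P′ a) * (suc n ∸ a) !
  P′-recurrence p q n a p+q≡1+n a≤n = begin
      p * (Q * f) + q * (((q ∸ 1) P′ a) * f)
    ≡⟨ cong (p * (Q * f) +_) (trans (sym (*-assoc q _ f)) (cong (_* f) (*-P′-pred q a))) ⟩
      p * (Q * f) + (q ∸ a) * Q * f
    ≡⟨ regroup p Q f (q ∸ a) ⟩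
      Q * ((p + (q ∸ a)) * f)
    ≡⟨ Q*-cong (a ≤? q) ⟩
      Q * (suc (n ∸ a)) !
    ≡⟨ cong (λ t → Q * t !) (sym [n+1]∸a) ⟩
      Q * (suc n ∸ a) ! ∎
    where
    open ≡-Reasoning
    Q = q P′ a
    f = (n ∸ a) !
    regroup : ∀ p Q f r → p * (Q * f) + r * Q * f ≡ Q * ((p + r) * f)
    regroup = solve-∀
    [n+1]∸a : suc n ∸ a ≡ suc (n ∸ a)
    [n+1]∸a = +-∸-assoc 1 a≤n
    Q*-cong : Dec (a ≤ q) → Q * ((p + (q ∸ a)) * f) ≡ Q * (suc (n ∸ a)) !
    Q*-cong (yes a≤q) = cong (λ t → Q * (t * f)) (begin
      p + (q ∸ a)   ≡⟨ sym (+-∸-assoc p a≤q) ⟩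
      p + q ∸ a     ≡⟨ cong (_∸ a) p+q≡1+n ⟩
      suc n ∸ a     ≡⟨ [n+1]∸a ⟩
      suc (n ∸ a)   ∎)
    Q*-cong (no a≰q) rewrite P′-vanishes (≰⇒> a≰q) = refl

  P′-*-^-mono : ∀ {x y E D} a → (∀ s → s < a → (x ∸ s) * E ≤ (y ∸ s) * D) →
                (x P′ a) * E ^ a ≤ (y P′ a) * D ^ a
  P′-*-^-mono zero    _     = ≤-refl
  P′-*-^-mono {x} {y} {E} {D} (suc a) factor =
    subst₂ _≤_ ([m*n]*[o*p]≡[m*o]*[n*p] (x ∸ a) E (x P′ a) (E ^ a))
               ([m*n]*[o*p]≡[m*o]*[n*p] (y ∸ a) D (y P′ a) (D ^ a))
      (*-mono-≤ (factor a ≤-refl) (P′-*-^-mono a (λ s s<a → factor s (m≤n⇒m≤1+n s<a))))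

module InjectiveVectors {m : ℕ} (B : Fin m → Bool) where

  open import Data.Nat using (zero; suc; _+_; _*_; _∸_; _!)
  open import Data.Nat.Properties
    using (*-zeroʳ; *-assoc; suc-injective; m+n∸m≡n; +-commutativeSemigroup)
  open import Data.Bool using (true; false; not; _∧_)
  open import Data.Bool.Properties using (∧-conicalˡ; ∧-conicalʳ; ∧-zeroʳ; not-involutive)
  open import Data.Fin using (zero; suc)
  open import Data.Vec using (Vec; []; _∷_; lookup; toList)
  open import Data.List.Relation.Unary.All as All using (All; []; _∷_)
  open import Data.List.Relation.Unary.AllPairs using ([]; _∷_)
  open import Data.List.Relation.Unary.Unique.Propositional using (Unique)
  open import Data.Product using (_×_; _,_; proj₁; proj₂)
  open import Function using (_∘_)
  open import Relation.Binary.PropositionalEquality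
  import Algebra.Properties.CommutativeSemigroup +-commutativeSemigroup as +-CS
  open import Defs using (allVecs)
  open BooleanCounting
  open FallingFactorial

  -- F holds the values still available and A marks the positions that must avoid B.  With A = J_μ,
  -- B = J_ν and every value available, the good vectors are the permutations σ with σ(J_μ) ∩ J_ν = ∅.
  Good : ∀ {n} → (Fin n → Bool) → (Fin m → Bool) → Vec (Fin m) n → Bool
  Good A F []      = true
  Good A F (i ∷ v) = F i ∧ not (A zero ∧ B i) ∧ Good (A ∘ suc) (remove i F) v

  forbidden allowed : (Fin m → Bool) → ℕ
  forbidden F = countᶠ (λ j → F j ∧ B j)
  allowed   F = countᶠ (λ j → F j ∧ not (B j))

  allFree : Fin m → Bool
  allFree _ = true

  size-allFree : forbidden allFree + allowed allFree ≡ m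
  size-allFree = countᶠ+countᶠ-not B

  Good-tail : ∀ {n} (A : Fin (suc n) → Bool) F i v → Good A F (i ∷ v) ≡ true →
              Good (A ∘ suc) (remove i F) v ≡ true
  Good-tail A F i v good = ∧-conicalʳ (not (A zero ∧ B i)) _ (∧-conicalʳ (F i) _ good)

  Good⇒Unique : ∀ {n} (A : Fin n → Bool) F (v : Vec (Fin m) n) → Good A F v ≡ true →
                Unique (toList v) × All (λ j → F j ≡ true) (toList v)
  Good⇒Unique A F []      _    = [] , []
  Good⇒Unique A F (i ∷ v) good
    with uniq , free ← Good⇒Unique (A ∘ suc) (remove i F) v (Good-tail A F i v good) =
      All.map (proj₁ ∘ remove-true⁻ {i = i} {F = F}) free ∷ uniq
    , ∧-conicalˡ (F i) _ good ∷ All.map (proj₂ ∘ remove-true⁻ {i = i} {F = F}) free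

  Unique⇒Good : ∀ {n} F (v : Vec (Fin m) n) →
                Unique (toList v) → All (λ j → F j ≡ true) (toList v) →
                Good (λ _ → false) F v ≡ true
  Unique⇒Good F []      _              _            = refl
  Unique⇒Good F (i ∷ v) (i∉v ∷ uniq) (Fi ∷ free) rewrite Fi =
    Unique⇒Good (remove i F) v uniq (All.zipWith (remove-true⁺ {i = i} {F = F}) (i∉v , free))

  Good⇒avoids : ∀ {n} (A : Fin n → Bool) F (v : Vec (Fin m) n) → Good A F v ≡ true →
                ∀ j → A j ≡ true → B (lookup v j) ≡ false
  Good⇒avoids A F (i ∷ v) good zero A₀ =
    trans (sym (not-involutive (B i)))
          (cong not (subst (λ b → not (b ∧ B i) ≡ true) A₀ (∧-conicalˡ _ _ (∧-conicalʳ (F i) _ good))))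
  Good⇒avoids A F (i ∷ v) good (suc j) =
    Good⇒avoids (A ∘ suc) (remove i F) v (Good-tail A F i v good) j

  -- The first entry is any available value, except that a value in B is excluded when position 0
  -- is marked; placing it removes it from F, lowering either forbidden F or allowed F by one.
  count-Good : ∀ n (A : Fin n → Bool) F → forbidden F + allowed F ≡ n →
    count (Good A F) (allVecs n m) ≡ (allowed F P′ countᶠ A) * (n ∸ countᶠ A) !
  count-Good zero    A F _    = refl
  count-Good (suc n) A F size = trans (count-allVecs-suc (Good A F)) (by-first-entry (A zero) refl)
    where
    open ≡-Reasoning
    a′ = countᶠ (A ∘ suc)
    q  = allowed F

    R : ℕ → ℕ
    R q′ = (q′ P′ a′) * (n ∸ a′) !

    h : Fin m → ℕ
    h i = count (λ v → Good A F (i ∷ v)) (allVecs n m)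

    used : ∀ i → F i ≡ false → h i ≡ 0
    used i Fi rewrite Fi = count-false (allVecs n m)

    blocked : ∀ i → A zero ≡ true → F i ≡ true → B i ≡ true → h i ≡ 0
    blocked i A₀ Fi Bi rewrite A₀ | Fi | Bi = count-false (allVecs n m)

    placed : ∀ i b → F i ≡ true → B i ≡ b → not (A zero ∧ b) ≡ true → h i ≡ R (q ∸ bit (not b))
    placed i b Fi Bi ok rewrite Fi | Bi | ok =
      trans (count-Good n (A ∘ suc) F′ size′)
            (cong R (trans allowed′ (cong (λ b → q ∸ bit (not b)) Bi)))
      where
      F′ = remove i F
      forbidden-split : forbidden F ≡ bit (B i) + forbidden F′
      forbidden-split = countᶠ-remove F B i Fi
      allowed-split : allowed F ≡ bit (not (B i)) + allowed F′
      allowed-split = countᶠ-remove F (not ∘ B) i Fi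
      size′ : forbidden F′ + allowed F′ ≡ n
      size′ = suc-injective (begin
        suc (forbidden F′ + allowed F′)
          ≡⟨ cong (_+ (forbidden F′ + allowed F′)) (sym (bit+bit-not (B i))) ⟩
        (bit (B i) + bit (not (B i))) + (forbidden F′ + allowed F′)
          ≡⟨ +-CS.interchange (bit (B i)) _ _ _ ⟩
        (bit (B i) + forbidden F′) + (bit (not (B i)) + allowed F′)
          ≡⟨ sym (cong₂ _+_ forbidden-split allowed-split) ⟩
        forbidden F + allowed F
          ≡⟨ size ⟩
        suc n ∎)
      allowed′ : allowed F′ ≡ q ∸ bit (not (B i))
      allowed′ = sym (trans (cong (_∸ bit (not (B i))) allowed-split) (m+n∸m≡n (bit (not (B i))) _))

    allowed-entry : ∀ i → F i ≡ true → B i ≡ false → h i ≡ R (q ∸ 1)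
    allowed-entry i Fi Bi = placed i false Fi Bi (cong not (∧-zeroʳ (A zero)))

    by-first-entry : ∀ b → A zero ≡ b → sum h ≡ (q P′ (bit b + a′)) * (suc n ∸ (bit b + a′)) !
    by-first-entry true A₀ = begin
        sum h
      ≡⟨ sum-by-class h F B 0 (R (q ∸ 1)) used (λ i → blocked i A₀) allowed-entry ⟩
        forbidden F * 0 + q * R (q ∸ 1)
      ≡⟨ cong (_+ q * R (q ∸ 1)) (*-zeroʳ (forbidden F)) ⟩
        q * R (q ∸ 1)
      ≡⟨ sym (*-assoc q _ _) ⟩
        q * ((q ∸ 1) P′ a′) * (n ∸ a′) !
      ≡⟨ cong (_* (n ∸ a′) !) (*-P′-pred q a′) ⟩
        (q P′ suc a′) * (n ∸ a′) ! ∎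
    by-first-entry false A₀ = begin
        sum h
      ≡⟨ sum-by-class h F B (R q) (R (q ∸ 1)) used forbidden-entry allowed-entry ⟩
        forbidden F * R q + q * R (q ∸ 1)
      ≡⟨ P′-recurrence (forbidden F) q n a′ size (countᶠ≤ (A ∘ suc)) ⟩
        (q P′ a′) * (suc n ∸ a′) ! ∎
      where
      forbidden-entry : ∀ i → F i ≡ true → B i ≡ true → h i ≡ R q
      forbidden-entry i Fi Bi = placed i true Fi Bi (cong (λ a → not (a ∧ true)) A₀)

module ChainConnectivity where

  open import Data.Bool using (true; false)
  open import Data.Fin using (zero; suc; inject₁; fromℕ)
  open import Data.Fin.Induction using (<-weakInduction)
  open import Data.Vec using (Vec; lookup)
  open import Relation.Binary.PropositionalEquality using (_≡_)
  open import Relation.Binary.Construct.Closure.ReflexiveTransitive using (Star; ε; _◅_; _◅◅_)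
  open import Defs

  avoids⇒connected : ∀ {k d} (L' : Fin k → Fin d → Bool) μ ν (σ : Vec (Fin d) d) →
    (∀ j → L' μ j ≡ true → L' ν (lookup σ j) ≡ false) → EndpointsConnected L' μ ν σ
  avoids⇒connected {d = d} L' μ ν σ avoids =
    <-weakInduction (λ j → Star (Step L' μ ν σ) (x zero) (x j))
                    ε (λ j path → path ◅◅ rung j) (fromℕ d)
    where
    rung : ∀ j → Star (Step L' μ ν σ) (x (inject₁ j)) (x (suc j))
    rung j with L' μ j in top
    ... | false = top₁ j top ◅ top₂ j top ◅ ε
    ... | true  = bot₁ j (avoids j top) ◅ bot₂ j (avoids j top) ◅ ε

module PermutationCount where

  open import Data.Nat using (_+_; _*_; _∸_; _^_; _≤_; _<_; _!)
  open import Data.Nat.Properties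
    using (*-identityˡ; *-monoʳ-≤; *-monoˡ-≤; m+n∸m≡n; m+n≤o⇒m≤o∸n; +-comm; *-commutativeSemigroup;
           module ≤-Reasoning)
  open import Data.Bool using (true; false)
  open import Data.Fin.Properties using (_≟_)
  open import Data.Vec using (Vec; toList)
  open import Data.List using (length; filter; allFin)
  open import Data.List.Relation.Unary.All using (universal)
  open import Data.List.Relation.Unary.Unique.Propositional using (Unique)
  import Data.List.Relation.Unary.Unique.DecPropositional as UniqueDec
  open import Data.Product using (proj₁)
  open import Relation.Binary.PropositionalEquality
  open import Relation.Nullary using (Dec; yes; ¬_)
  open import Relation.Nullary.Decidable using (dec-true)
  import Algebra.Properties.CommutativeSemigroup *-commutativeSemigroup as *-CS
  open import Defs
  open BooleanCounting
  open FallingFactorial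
  open ChainConnectivity

  isPerm⇒Unique : ∀ {d} (σ : Vec (Fin d) d) → isPerm σ ≡ true → Unique (toList σ)
  isPerm⇒Unique σ perm with UniqueDec.unique? _≟_ (toList σ)
  ... | yes uniq = uniq

  Unique⇒isPerm : ∀ {d} (σ : Vec (Fin d) d) → Unique (toList σ) → isPerm σ ≡ true
  Unique⇒isPerm σ = dec-true (UniqueDec.unique? _≟_ (toList σ))

  ∣J∣≡countᶠ : ∀ {k d} (L' : Fin k → Fin d → Bool) μ → ∣J∣ L' μ ≡ countᶠ (L' μ)
  ∣J∣≡countᶠ {d = d} L' μ =
    trans (sym (count≡length-filter (L' μ) (allFin d))) (count-tabulate (L' μ) (λ j → j))

  #perms≤d! : ∀ d → length (allPerms d) ≤ d !
  #perms≤d! d = begin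
      length (allPerms d)
    ≡⟨ sym (count≡length-filter isPerm (allVecs d d)) ⟩
      count isPerm (allVecs d d)
    ≤⟨ count-mono (λ σ perm → Unique⇒Good allFree σ (isPerm⇒Unique σ perm) (universal (λ _ → refl) _))
                  (allVecs d d) ⟩
      count (Good none allFree) (allVecs d d)
    ≡⟨ count-Good d none allFree size-allFree ⟩
      (allowed allFree P′ countᶠ none) * (d ∸ countᶠ none) !
    ≡⟨ cong (λ a → (allowed allFree P′ a) * (d ∸ a) !) (sum-replicate-zero d) ⟩
      1 * d !
    ≡⟨ *-identityˡ (d !) ⟩
      d ! ∎
    where
    open ≤-Reasoning
    none : Fin d → Bool
    none _ = false
    open InjectiveVectors none

  module _ {k d} (L' : Fin k → Fin d → Bool) (μ ν : Fin k) where

    open InjectiveVectors (L' ν)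

    #good-perms : count (Good (L' μ) allFree) (allPerms d)
                  ≡ (allowed allFree P′ countᶠ (L' μ)) * (d ∸ countᶠ (L' μ)) !
    #good-perms =
      trans (count-filter (λ σ good → Unique⇒isPerm σ (proj₁ (Good⇒Unique (L' μ) allFree σ good)))
                          (allVecs d d))
            (count-Good d (L' μ) allFree size-allFree)

    #disconnected+#good≤#perms : (dec : (σ : Vec (Fin d) d) → Dec (¬ EndpointsConnected L' μ ν σ)) →
      length (filter dec (allPerms d)) + count (Good (L' μ) allFree) (allPerms d) ≤ length (allPerms d)
    #disconnected+#good≤#perms dec =
      length-filter+count≤length dec (Good (L' μ) allFree)
        (λ σ good disconnected →
           disconnected (avoids⇒connected L' μ ν σ (Good⇒avoids (L' μ) allFree σ good)))
        (allPerms d)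

    disconnection-bound : (dec : (σ : Vec (Fin d) d) → Dec (¬ EndpointsConnected L' μ ν σ)) → ∀ {E D} →
      (∀ s → s < ∣J∣ L' μ → (d ∸ s) * E ≤ (d ∸ ∣J∣ L' ν ∸ s) * D) →
      let N = length (allPerms d) in
      E ^ ∣J∣ L' μ * N ≤ (N ∸ length (filter dec (allPerms d))) * D ^ ∣J∣ L' μ
    disconnection-bound dec {E} {D} factor rewrite ∣J∣≡countᶠ L' μ | ∣J∣≡countᶠ L' ν = begin
        E ^ a * N
      ≤⟨ *-monoʳ-≤ (E ^ a) (#perms≤d! d) ⟩
        E ^ a * d !
      ≡⟨ cong (E ^ a *_) (sym (P′-*-! (countᶠ≤ (L' μ)))) ⟩
        E ^ a * ((d P′ a) * (d ∸ a) !)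
      ≡⟨ *-CS.x∙yz≈yx∙z (E ^ a) (d P′ a) ((d ∸ a) !) ⟩
        (d P′ a) * E ^ a * (d ∸ a) !
      ≤⟨ *-monoˡ-≤ ((d ∸ a) !) (P′-*-^-mono a factor′) ⟩
        (q P′ a) * D ^ a * (d ∸ a) !
      ≡⟨ *-CS.xy∙z≈xz∙y (q P′ a) (D ^ a) ((d ∸ a) !) ⟩
        (q P′ a) * (d ∸ a) ! * D ^ a
      ≡⟨ cong (_* D ^ a) (sym #good-perms) ⟩
        G * D ^ a
      ≤⟨ *-monoˡ-≤ (D ^ a)
          (m+n≤o⇒m≤o∸n G (subst (_≤ N) (+-comm Bc G) (#disconnected+#good≤#perms dec))) ⟩
        (N ∸ Bc) * D ^ a ∎
      where
      open ≤-Reasoning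
      a = countᶠ (L' μ)
      q = allowed allFree
      N = length (allPerms d)
      Bc = length (filter dec (allPerms d))
      G = count (Good (L' μ) allFree) (allPerms d)
      q≡d∸∣J∣ : d ∸ countᶠ (L' ν) ≡ q
      q≡d∸∣J∣ = trans (cong (_∸ countᶠ (L' ν)) (sym size-allFree)) (m+n∸m≡n (countᶠ (L' ν)) q)
      factor′ : ∀ s → s < a → (d ∸ s) * E ≤ (q ∸ s) * D
      factor′ s s<a = subst (λ y → (d ∸ s) * E ≤ (y ∸ s) * D) q≡d∸∣J∣ (factor s s<a)

module Estimates where

  open import Data.Nat using (zero; suc; _+_; _*_; _∸_; _^_; _≤_; _<_)
  open import Data.Nat.Properties
  open import Relation.Binary.PropositionalEquality
  open import Data.Nat.Tactic.RingSolver using (solve-∀)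
  import Algebra.Properties.CommutativeSemigroup *-commutativeSemigroup as *-CS

  -- The factor inequality (d − s)(1 − 8c/(dk)) ≤ d − n − s with denominators cleared; it only
  -- needs 2s < d, which follows from k(s+1) ≤ 4c < dk/2.
  factor-bound : ∀ {d k c a n s} → k * a ≤ 4 * c → k * n ≤ 4 * c → 8 * c < d * k → s < a →
                 (d ∸ s) * (d * k ∸ 8 * c) ≤ (d ∸ n ∸ s) * (d * k)
  factor-bound {d} {k} {c} {a} {n} {s} ka≤4c kn≤4c 8c<dk s<a = begin
      t * (d * k ∸ 8 * c)         ≡⟨ *-distribˡ-∸ t (d * k) (8 * c) ⟩
      t * (d * k) ∸ t * (8 * c)   ≤⟨ ∸-monoʳ-≤ (t * (d * k)) ndk≤8ct ⟩
      t * (d * k) ∸ n * (d * k)   ≡⟨ sym (*-distribʳ-∸ (d * k) t n) ⟩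
      (t ∸ n) * (d * k)           ≡⟨ cong (_* (d * k)) ∸-swap ⟩
      (d ∸ n ∸ s) * (d * k)       ∎
    where
    open ≤-Reasoning
    t = d ∸ s
    ∸-swap : d ∸ s ∸ n ≡ d ∸ n ∸ s
    ∸-swap = trans (∸-+-assoc d s n) (trans (cong (d ∸_) (+-comm s n)) (sym (∸-+-assoc d n s)))
    2s<d : s + s < d
    2s<d = *-cancelˡ-< k (s + s) d (begin-strict
      k * (s + s)         ≡⟨ *-distribˡ-+ k s s ⟩
      k * s + k * s       ≤⟨ +-mono-≤ ks≤4c ks≤4c ⟩
      4 * c + 4 * c       ≡⟨ 4c+4c≡8c c ⟩
      8 * c               <⟨ 8c<dk ⟩
      d * k               ≡⟨ *-comm d k ⟩
      k * d               ∎)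
      where
      ks≤4c : k * s ≤ 4 * c
      ks≤4c = ≤-trans (*-monoʳ-≤ k (<⇒≤ s<a)) ka≤4c
      4c+4c≡8c : ∀ c → 4 * c + 4 * c ≡ 8 * c
      4c+4c≡8c = solve-∀
    d≤t+t : d ≤ t + t
    d≤t+t = begin
      d       ≡⟨ sym (m+[n∸m]≡n (≤-trans (m≤m+n s s) (<⇒≤ 2s<d))) ⟩
      s + t   ≤⟨ +-monoˡ-≤ t (m+n≤o⇒m≤o∸n s (<⇒≤ 2s<d)) ⟩
      t + t   ∎
    ndk≤8ct : n * (d * k) ≤ t * (8 * c)
    ndk≤8ct = begin
      n * (d * k)       ≡⟨ regroup n d k ⟩
      (k * n) * d       ≤⟨ *-mono-≤ kn≤4c d≤t+t ⟩
      (4 * c) * (t + t) ≡⟨ double c t ⟩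
      t * (8 * c)       ∎
      where
      regroup : ∀ n d k → n * (d * k) ≡ (k * n) * d
      regroup = solve-∀
      double : ∀ c t → (4 * c) * (t + t) ≡ t * (8 * c)
      double = solve-∀

  ^-distribʳ-* : ∀ x y n → (x * y) ^ n ≡ x ^ n * y ^ n
  ^-distribʳ-* x y zero    = refl
  ^-distribʳ-* x y (suc n) =
    trans (cong (x * y *_) (^-distribʳ-* x y n)) ([m*n]*[o*p]≡[m*o]*[n*p] x y (x ^ n) (y ^ n))

  power-bound : ∀ {E D N R a k e} → E ^ a * N ≤ R * D ^ a → a * k ≤ e → E ≤ D →
                E ^ e * N ^ k ≤ R ^ k * D ^ e
  power-bound {E} {D} {N} {R} {a} {k} {e} base ak≤e E≤D = begin
      E ^ e * N ^ k             ≡⟨ regroup E N ⟩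
      (E ^ a * N) ^ k * E ^ r   ≤⟨ *-mono-≤ (^-monoˡ-≤ k (subst (E ^ a * N ≤_) (*-comm R (D ^ a)) base))
                                            (^-monoˡ-≤ r E≤D) ⟩
      (D ^ a * R) ^ k * D ^ r   ≡⟨ sym (regroup D R) ⟩
      D ^ e * R ^ k             ≡⟨ *-comm (D ^ e) (R ^ k) ⟩
      R ^ k * D ^ e             ∎
    where
    open ≤-Reasoning
    r = e ∸ a * k
    regroup : ∀ X Y → X ^ e * Y ^ k ≡ (X ^ a * Y) ^ k * X ^ r
    regroup X Y = begin-equality
      X ^ e * Y ^ k                ≡⟨ cong (λ i → X ^ i * Y ^ k) (sym (m+[n∸m]≡n ak≤e)) ⟩
      X ^ (a * k + r) * Y ^ k      ≡⟨ cong (_* Y ^ k) (^-distribˡ-+-* X (a * k) r) ⟩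
      X ^ (a * k) * X ^ r * Y ^ k  ≡⟨ *-CS.xy∙z≈xz∙y (X ^ (a * k)) (X ^ r) (Y ^ k) ⟩
      X ^ (a * k) * Y ^ k * X ^ r  ≡⟨ cong (λ Z → Z * Y ^ k * X ^ r) (sym (^-*-assoc X a k)) ⟩
      (X ^ a) ^ k * Y ^ k * X ^ r  ≡⟨ cong (_* X ^ r) (sym (^-distribʳ-* (X ^ a) Y k)) ⟩
      (X ^ a * Y) ^ k * X ^ r      ∎

module NaturalFractions where

  open import Data.Nat as ℕ using (zero; suc; _∸_; _^_; NonZero)
  import Data.Nat.Properties as ℕ
  open import Data.Integer as ℤ using (+_)
  import Data.Integer.Properties as ℤ
  open import Data.Rational using (1ℚ; 0ℚ; toℚᵘ; -_; _-_; _+_; _*_; _≤_)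
  import Data.Rational.Properties as ℚ
  open import Data.Rational.Unnormalised as ℚᵘ using (mkℚᵘ; *≡*; *≤*)
  import Data.Rational.Unnormalised.Properties as ℚᵘ
  open import Relation.Binary.PropositionalEquality
  open import Data.Nat.Tactic.RingSolver using (solve-∀)
  open import Defs using (_÷ℕ_; _^ℚ_)

  toℚᵘ-÷ℕ : ∀ a b → toℚᵘ (a ÷ℕ suc b) ℚᵘ.≃ mkℚᵘ (+ a) b
  toℚᵘ-÷ℕ a b = ℚ.toℚᵘ-fromℚᵘ (mkℚᵘ (+ a) b)

  +*+ : ∀ a b → + a ℤ.* + b ≡ + (a ℕ.* b)
  +*+ a b = sym (ℤ.pos-* a b)

  ÷ℕ-mono-≤ : ∀ a b c e .{{_ : NonZero b}} .{{_ : NonZero e}} →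
              a ℕ.* e ℕ.≤ c ℕ.* b → a ÷ℕ b ≤ c ÷ℕ e
  ÷ℕ-mono-≤ a (suc b) c (suc e) ae≤cb = ℚ.toℚᵘ-cancel-≤
    (ℚᵘ.≤-respˡ-≃ (ℚᵘ.≃-sym (toℚᵘ-÷ℕ a b)) (ℚᵘ.≤-respʳ-≃ (ℚᵘ.≃-sym (toℚᵘ-÷ℕ c e))
      (*≤* (subst₂ ℤ._≤_ (ℤ.pos-* a (suc e)) (ℤ.pos-* c (suc b)) (ℤ.+≤+ ae≤cb)))))

  ÷ℕ-*-÷ℕ : ∀ a b c e .{{_ : NonZero b}} .{{_ : NonZero e}} →
            (a ÷ℕ b) * (c ÷ℕ e) ≡ (a ℕ.* c) ÷ℕ (b ℕ.* e)
  ÷ℕ-*-÷ℕ a (suc b) c (suc e) = ℚ.toℚᵘ-injective (begin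
      toℚᵘ ((a ÷ℕ suc b) * (c ÷ℕ suc e))      ≈⟨ ℚ.toℚᵘ-homo-* (a ÷ℕ suc b) (c ÷ℕ suc e) ⟩
      toℚᵘ (a ÷ℕ suc b) ℚᵘ.* toℚᵘ (c ÷ℕ suc e) ≈⟨ ℚᵘ.*-cong (toℚᵘ-÷ℕ a b) (toℚᵘ-÷ℕ c e) ⟩
      mkℚᵘ (+ a) b ℚᵘ.* mkℚᵘ (+ c) e           ≈⟨ *≡* (cong (ℤ._* + (suc b ℕ.* suc e)) (+*+ a c)) ⟩
      mkℚᵘ (+ (a ℕ.* c)) (e ℕ.+ b ℕ.* suc e)  ≈⟨ ℚᵘ.≃-sym (toℚᵘ-÷ℕ (a ℕ.* c) (e ℕ.+ b ℕ.* suc e)) ⟩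
      toℚᵘ ((a ℕ.* c) ÷ℕ (suc b ℕ.* suc e))   ∎)
    where open ℚᵘ.≃-Reasoning

  ÷ℕ-^ℚ : ∀ a b n .{{_ : NonZero b}} → (a ÷ℕ b) ^ℚ n ≡ (a ^ n) ÷ℕ (b ^ n)
  ÷ℕ-^ℚ a b zero    = refl
  ÷ℕ-^ℚ a b (suc n) {{b≢0}} =
    trans (cong ((a ÷ℕ b) *_) (÷ℕ-^ℚ a b n)) (÷ℕ-*-÷ℕ a b (a ^ n) (b ^ n) {{b≢0}} {{ℕ.m^n≢0 b n}})

  ÷ℕ-+-÷ℕ : ∀ a c b → (a ÷ℕ suc b) + (c ÷ℕ suc b) ≡ (a ℕ.+ c) ÷ℕ suc b
  ÷ℕ-+-÷ℕ a c b = ℚ.toℚᵘ-injective (begin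
      toℚᵘ ((a ÷ℕ suc b) + (c ÷ℕ suc b))       ≈⟨ ℚ.toℚᵘ-homo-+ (a ÷ℕ suc b) (c ÷ℕ suc b) ⟩
      toℚᵘ (a ÷ℕ suc b) ℚᵘ.+ toℚᵘ (c ÷ℕ suc b) ≈⟨ ℚᵘ.+-cong (toℚᵘ-÷ℕ a b) (toℚᵘ-÷ℕ c b) ⟩
      mkℚᵘ (+ a) b ℚᵘ.+ mkℚᵘ (+ c) b           ≈⟨ *≡* numerators ⟩
      mkℚᵘ (+ (a ℕ.+ c)) b                     ≈⟨ ℚᵘ.≃-sym (toℚᵘ-÷ℕ (a ℕ.+ c) b) ⟩
      toℚᵘ ((a ℕ.+ c) ÷ℕ suc b)                ∎)
    where
    open ℚᵘ.≃-Reasoning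
    S = suc b
    numerators : (+ a ℤ.* + S ℤ.+ + c ℤ.* + S) ℤ.* + S ≡ + (a ℕ.+ c) ℤ.* + (S ℕ.* S)
    numerators rewrite +*+ a S | +*+ c S | +*+ (a ℕ.* S ℕ.+ c ℕ.* S) S | +*+ (a ℕ.+ c) (S ℕ.* S) =
      cong +_ (distrib a c S)
      where
      distrib : ∀ a c S → (a ℕ.* S ℕ.+ c ℕ.* S) ℕ.* S ≡ (a ℕ.+ c) ℕ.* (S ℕ.* S)
      distrib = solve-∀

  1-÷ℕ : ∀ n m .{{_ : NonZero m}} → n ℕ.≤ m → 1ℚ - (n ÷ℕ m) ≡ (m ∸ n) ÷ℕ m
  1-÷ℕ n (suc m) n≤m = begin
      1ℚ - y                ≡⟨ cong (_- y) (sym z+y≡1) ⟩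
      (z + y) - y           ≡⟨ ℚ.+-assoc z y (- y) ⟩
      z + (y - y)           ≡⟨ cong (λ w → z + w) (ℚ.+-inverseʳ y) ⟩
      z + 0ℚ                ≡⟨ ℚ.+-identityʳ z ⟩
      z                     ∎
    where
    open ≡-Reasoning
    y = n ÷ℕ suc m
    z = (suc m ∸ n) ÷ℕ suc m
    z+y≡1 : z + y ≡ 1ℚ
    z+y≡1 = trans (÷ℕ-+-÷ℕ (suc m ∸ n) n m) (trans (cong (_÷ℕ suc m) (ℕ.m∸n+n≡m n≤m))
              (ℚ.toℚᵘ-injective (ℚᵘ.≃-trans (toℚᵘ-÷ℕ (suc m) m) (*≡* (ℤ.*-comm (+ suc m) (+ 1))))))

  1ℚ^ℚ : ∀ k → 1ℚ ^ℚ k ≡ 1ℚ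
  1ℚ^ℚ zero    = refl
  1ℚ^ℚ (suc k) = trans (cong (1ℚ *_) (1ℚ^ℚ k)) (ℚ.*-identityˡ 1ℚ)

  [1-÷ℕ]^ℚ : ∀ n m e .{{_ : NonZero m}} → n ℕ.≤ m →
             (1ℚ - (n ÷ℕ m)) ^ℚ e ≡ ((m ∸ n) ^ e) ÷ℕ (m ^ e)
  [1-÷ℕ]^ℚ n m e n≤m = trans (cong (_^ℚ e) (1-÷ℕ n m n≤m)) (÷ℕ-^ℚ (m ∸ n) m e)

  [1-÷ℕ]^ℚ-mono : ∀ {x D B N e k} .{{_ : NonZero D}} → x ℕ.≤ D → B ℕ.≤ N →
    (D ∸ x) ^ e ℕ.* N ^ k ℕ.≤ (N ∸ B) ^ k ℕ.* D ^ e →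
    (1ℚ - (x ÷ℕ D)) ^ℚ e ≤ (1ℚ - (B ÷ℕ N)) ^ℚ k
  -- With N = 0 the hypothesis says nothing, but B ÷ℕ 0 is the junk value 0ℚ, so the right side is 1.
  [1-÷ℕ]^ℚ-mono {x} {D} {B} {zero} {e} {k} x≤D _ _ = begin
      (1ℚ - (x ÷ℕ D)) ^ℚ e      ≡⟨ [1-÷ℕ]^ℚ x D e x≤D ⟩
      ((D ∸ x) ^ e) ÷ℕ (D ^ e)  ≤⟨ ÷ℕ-mono-≤ _ (D ^ e) 1 1 {{ℕ.m^n≢0 D e}} (subst₂ ℕ._≤_
                                    (sym (ℕ.*-identityʳ _)) (sym (ℕ.*-identityˡ _)) (ℕ.^-monoˡ-≤ e (ℕ.m∸n≤m D x))) ⟩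
      1ℚ                        ≡⟨ sym (1ℚ^ℚ k) ⟩
      (1ℚ - (B ÷ℕ zero)) ^ℚ k   ∎
    where open ℚ.≤-Reasoning
  [1-÷ℕ]^ℚ-mono {x} {D} {B} {suc N} {e} {k} x≤D B≤N bound =
    subst₂ _≤_ (sym ([1-÷ℕ]^ℚ x D e x≤D)) (sym ([1-÷ℕ]^ℚ B (suc N) k B≤N))
      (÷ℕ-mono-≤ _ (D ^ e) _ (suc N ^ k) {{ℕ.m^n≢0 D e}} {{ℕ.m^n≢0 (suc N) k}} bound)

open import Defs
open import Data.Nat using (ℕ; _*_; _<_; NonZero)
open import Data.Fin using (Fin) renaming (_<_ to _<ᶠ_)
open import Data.Vec using (Vec)
open import Data.Rational using (1ℚ; _-_; _≤_)
open import Relation.Binary.PropositionalEquality using (_≡_)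
open import Relation.Nullary using (Dec; ¬_)
open import Data.Bool using (Bool)

import Data.Nat as ℕ
open import Data.Nat.Properties using (<⇒≤; m∸n≤m; *-comm)
open import Data.List using (length; filter)
open import Data.List.Properties using (length-filter)
open import Relation.Binary.PropositionalEquality using (subst)
open PermutationCount using (disconnection-bound)
open Estimates using (factor-bound; power-bound)
open NaturalFractions using ([1-÷ℕ]^ℚ-mono)

lemma3 : (k d h : ℕ) → NonZero k → NonZero d → NonZero h →
    (L' : Fin k → Fin d → Bool) → (c : ℕ) → ∣L'∣ L' ≡ c →
    8 * c < d * k →
    (μ ν : Fin k) → μ <ᶠ ν → Light L' μ → Light L' ν → (i : Fin h) →
    (dec : (σ : Vec (Fin d) d) → Dec (¬ EndpointsConnected L' μ ν σ)) →
    ((1ℚ - ((8 * c) ÷ℕ (d * k))) ^ℚ (4 * c))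
      ≤ ((1ℚ - Prob d (λ σ → ¬ EndpointsConnected L' μ ν σ) dec) ^ℚ k)
-- Neither μ < ν nor the chain index i is used: each chain C^i_{μν} carries a uniform permutation.
lemma3 k@(ℕ.suc _) d@(ℕ.suc _) _ _ _ _ L' c ∣L'∣≡c 8c<dk μ ν _ light-μ light-ν _ dec =
  [1-÷ℕ]^ℚ-mono {e = 4 * c} {k = k} (<⇒≤ 8c<dk) (length-filter dec (allPerms d)) count-bound
  where
  N = length (allPerms d)
  N-disconnected = length (filter dec (allPerms d))

  light-bound : ∀ {λ′} → Light L' λ′ → k * ∣J∣ L' λ′ ℕ.≤ 4 * c
  light-bound {λ′} = subst (λ c → k * ∣J∣ L' λ′ ℕ.≤ 4 * c) ∣L'∣≡c

  count-bound : (d * k ℕ.∸ 8 * c) ℕ.^ (4 * c) * N ℕ.^ k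
                ℕ.≤ (N ℕ.∸ N-disconnected) ℕ.^ k * (d * k) ℕ.^ (4 * c)
  count-bound = power-bound {R = N ℕ.∸ N-disconnected} {a = ∣J∣ L' μ} {k = k}
    (disconnection-bound L' μ ν dec
      (λ _ → factor-bound {c = c} (light-bound light-μ) (light-bound light-ν) 8c<dk))
    (subst (ℕ._≤ 4 * c) (*-comm k (∣J∣ L' μ)) (light-bound light-μ))
    (m∸n≤m (d * k) (8 * c))
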